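{- Let $G$ be the infinite grid graph with vertex set $\mathbb{Z}^2$ and let $f$ be a conservative flow configuration on $G$ with finite support (only finitely many edges have nonzero flow). Then every run of the flow-firing process started from $f$ terminates after finitely many steps, i.e. there is no infinite sequence of firings starting from $f$.
   Context: Each edge of the grid graph $G$ (vertices $\mathbb{Z}^2$, edges between points at Euclidean distance $1$) is oriented from South to North or from West to East. A flow configuration is a function $f$ assigning an integer $f_e$ to each edge $e$; $f_e>0$ means $f_e$ units of flow along the orientation of $e$, $f_e<0$ means $|f_e|$ units against it. It is conservative if for every vertex $v$, $\mathrm{inflow}(v)-\mathrm{outflow}(v)=\sum_{e \text{ oriented into } v} f_e-\sum_{e \text{ oriented out of } v} f_e=0$. The faces of $G$ are the unit squares; each edge lies in exactly two faces. Rerouting one unit of flow on an edge $e$ across a face $\sigma\ni e$ means replacing one unit of flow along $e$ (in the direction in which flow currently runs on $e$) by one unit of flow along the path formed by the other three edges of $\sigma$ (same endpoints), adding these to existing values (opposite flows cancel). Flow-firing process: at each step choose an edge $e$ with $|f_e|\ge2$ and fire it, i.e. reroute one unit of its flow across each of the two faces containing $e$. The process terminates when no edge has $|f_e|\ge 2$. -}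

module Defs where

open import Data.Nat using (ℕ; zero; suc)
open import Data.Integer using (ℤ; +_; -[1+_]; _+_; _-_; _*_; -_)
open import Data.Integer.Properties using (_≟_)
open import Data.Bool using (Bool; true; false; _∧_)
open import Relation.Nullary.Decidable using (⌊_⌋)
open import Data.List using (List)
open import Data.List.Membership.Propositional using (_∈_)
open import Data.Product using (∃)
open import Relation.Binary.PropositionalEquality using (_≡_)
open import Relation.Nullary using (¬_)

-- Edges of the grid graph on ℤ².
--   horiz x y : the edge from (x,y) to (x+1,y), oriented West → East
--   vert  x y : the edge from (x,y) to (x,y+1), oriented South → North
data Edge : Set where
  horiz : ℤ → ℤ → Edge
  vert  : ℤ → ℤ → Edge

Config : Set
Config = Edge → ℤ

FiniteSupport : Config → Set
FiniteSupport f = ∃ λ (L : List Edge) → ∀ e → ¬ (f e ≡ + 0) → e ∈ L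

Conservative : Config → Set
Conservative f = ∀ (x y : ℤ) →
  (f (horiz (x - + 1) y) + f (vert x (y - + 1))) - (f (horiz x y) + f (vert x y)) ≡ + 0

private
  ind : Bool → ℤ
  ind true  = + 1
  ind false = + 0

  _==_ : ℤ → ℤ → Bool
  a == b = ⌊ a ≟ b ⌋

-- Faces: face a b is the unit square [a,a+1]×[b,b+1].
-- cyc a b e : coefficient of edge e in the counterclockwise boundary cycle
-- of face a b, i.e.  horiz a b + vert (a+1) b - horiz a (b+1) - vert a b.
cyc : ℤ → ℤ → Edge → ℤ
cyc a b (horiz x y) = ind ((x == a) ∧ (y == b)) - ind ((x == a) ∧ (y == (b + + 1)))
cyc a b (vert x y)  = ind ((x == (a + + 1)) ∧ (y == b)) - ind ((x == a) ∧ (y == b))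

sgn : ℤ → ℤ
sgn (+ zero)  = + 0
sgn (+ suc _) = + 1
sgn -[1+ _ ]  = - (+ 1)

-- Rerouting one unit of flow on e (in its current direction, sign s) across a
-- face σ ∋ e: f ↦ f - s·e + s·(path along the other three edges of σ).
-- If ε = cyc σ e (= ±1), the boundary of σ oriented along e is ε·cyc σ, and the
-- path equals e - ε·cyc σ, so the result is f - s·ε·cyc σ.
reroute : Config → Edge → ℤ → ℤ → Config
reroute f e a b e' = f e' - sgn (f e) * (cyc a b e * cyc a b e')

-- The two faces containing an edge:
--   horiz x y lies in faces (x,y) and (x,y-1);
--   vert  x y lies in faces (x,y) and (x-1,y).
-- Firing e reroutes one unit across each of them (both with the sign of f e
-- the second reroute uses the sign of the intermediate flow on e, which equals
-- the original sign since |f e| ≥ 2).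
fire : Config → Edge → Config
fire f e@(horiz x y) = reroute (reroute f e x y) e x (y - + 1)
fire f e@(vert x y)  = reroute (reroute f e x y) e (x - + 1) y

run : Config → (ℕ → Edge) → ℕ → Config
run f es zero    = f
run f es (suc n) = fire (run f es n) (es n)

module Submission where

-- A conservative flow f of finite support on the planar grid is the coboundary of
-- a finitely supported height function h on faces: f e = h (plus e) - h (minus e),
-- where plus e and minus e are the two faces containing e.  Rerouting one unit of
-- flow across a face σ changes h only at σ, by ±1; so firing an edge e with
-- |f e| ≥ 2 moves one unit of height from plus e to minus e in the direction
-- s = sgn (f e), i.e. (a, b) ↦ (a - s, b + s) with a - b = f e.  This changes the
-- energy Σ h² by 2 - 2·|a - b| ≤ -2.  A run of firings therefore produces a strictly
-- decreasing sequence of natural numbers, which cannot be infinite.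

open import Defs
open import Data.Nat as ℕ using (ℕ; zero; suc; _≤_; _<_; s≤s; z≤n)
import Data.Nat.Properties as ℕP
open import Data.Nat.ListAction using (sum)
open import Data.Nat.Induction using (<-wellFounded)
import Data.Nat.Tactic.RingSolver as ℕ-Ring
open import Data.Integer as ℤ using (ℤ; +_; -[1+_]; +[1+_]; _+_; _-_; _*_; -_; ∣_∣)
import Data.Integer.Properties as ℤP
open import Data.Integer.Properties using (_≟_)
import Data.Integer.Tactic.RingSolver as ℤ-Ring
open import Data.Bool using (Bool; true; false; _∧_)
open import Data.Product using (_×_; _,_; proj₁; proj₂; Σ)
open import Data.Product.Properties using (≡-dec)
open import Data.Sum using (inj₁; inj₂)
open import Data.Empty using (⊥; ⊥-elim)
open import Data.List using (List; []; _∷_; map; cartesianProduct; deduplicate)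
open import Data.List.Membership.Propositional using (_∈_; _∉_)
open import Data.List.Membership.Propositional.Properties using (∈-cartesianProduct⁺; ∈-deduplicate⁺)
open import Data.List.Relation.Unary.Any using (here; there)
open import Data.List.Relation.Unary.All as All using ()
open import Data.List.Relation.Unary.All.Properties using (¬Any⇒All¬)
open import Data.List.Relation.Unary.AllPairs using (_∷_)
open import Data.List.Relation.Unary.Unique.Propositional using (Unique)
open import Data.List.Relation.Binary.Subset.Propositional using (_⊆_)
open import Induction.WellFounded using (Acc; acc)
open import Relation.Nullary using (¬_; Dec; yes; no)
open import Relation.Nullary.Decidable using (⌊_⌋; _×-dec_)
open import Relation.Binary.PropositionalEquality
open import Function using (_∘_; id)

sgn-*-self : ∀ z → sgn z * z ≡ + ∣ z ∣
sgn-*-self (+ zero)  = refl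
sgn-*-self +[1+ n ]  = ℤP.*-identityˡ +[1+ n ]
sgn-*-self -[1+ n ]  = ℤP.-1*i≡-i -[1+ n ]

sgn-unit : ∀ z → z ≢ + 0 → sgn z * sgn z ≡ + 1
sgn-unit (+ zero) z≢0 = ⊥-elim (z≢0 refl)
sgn-unit +[1+ n ] _   = refl
sgn-unit -[1+ n ] _   = refl

-- Removing one unit of flow from a value of absolute value at least 2 keeps its sign;
-- this is why both reroutes of a firing push flow in the same direction.
sgn-after-unit : ∀ z → 2 ≤ ∣ z ∣ → sgn (z - sgn z * + 1) ≡ sgn z
sgn-after-unit (+ suc (suc n)) _         = refl
sgn-after-unit -[1+ suc n ]    _         = refl
sgn-after-unit (+ 0)           ()
sgn-after-unit (+ 1)           (s≤s ())
sgn-after-unit -[1+ 0 ]        (s≤s ())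

sq : ℤ → ℕ
sq z = ∣ z ∣ ℕ.* ∣ z ∣

sq-ℤ : ∀ z → + sq z ≡ z * z
sq-ℤ (+ zero) = refl
sq-ℤ +[1+ n ] = refl
sq-ℤ -[1+ n ] = refl

-- Moving one unit from a towards b changes a² + b² by 2 - 2·|a - b|
-- (expanding the squares; s·(a - b) = |a - b| and s·s = 1 for s = sgn (a - b)).
unit-move-balance : ∀ a b → a - b ≢ + 0 →
  sq (a - sgn (a - b)) ℕ.+ sq (b + sgn (a - b)) ℕ.+ 2 ℕ.* ∣ a - b ∣ ≡ sq a ℕ.+ sq b ℕ.+ 2
unit-move-balance a b a-b≢0 = ℤP.+-injective (begin
    + sq (a - s) + + sq (b + s) + + (2 ℕ.* ∣ a - b ∣)
  ≡⟨ cong₃ (λ u v w → u + v + w) (sq-ℤ (a - s)) (sq-ℤ (b + s)) (ℤP.pos-* 2 ∣ a - b ∣) ⟩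
    (a - s) * (a - s) + (b + s) * (b + s) + + 2 * + ∣ a - b ∣
  ≡⟨ cong (λ v → (a - s) * (a - s) + (b + s) * (b + s) + + 2 * v) (sym (sgn-*-self (a - b))) ⟩
    (a - s) * (a - s) + (b + s) * (b + s) + + 2 * (s * (a - b))
  ≡⟨ expand a b s ⟩
    a * a + b * b + + 2 * (s * s)
  ≡⟨ cong₃ (λ u v w → u + v + + 2 * w) (sym (sq-ℤ a)) (sym (sq-ℤ b)) (sgn-unit (a - b) a-b≢0) ⟩
    + sq a + + sq b + + 2
  ∎)
  where
  open ≡-Reasoning
  s = sgn (a - b)
  expand : ∀ a b s → (a - s) * (a - s) + (b + s) * (b + s) + + 2 * (s * (a - b))
                     ≡ a * a + b * b + + 2 * (s * s)
  expand = ℤ-Ring.solve-∀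
  cong₃ : ∀ {A B C D : Set} (f : A → B → C → D) {x x' y y' z z'} →
          x ≡ x' → y ≡ y' → z ≡ z' → f x y z ≡ f x' y' z'
  cong₃ f refl refl refl = refl

unit-move-decreases : ∀ a b → 2 ≤ ∣ a - b ∣ →
  sq (a - sgn (a - b)) ℕ.+ sq (b + sgn (a - b)) < sq a ℕ.+ sq b
unit-move-decreases a b 2≤d = ℕP.+-cancelʳ-< 2 _ _ (begin-strict
    new ℕ.+ 2          <⟨ ℕP.+-monoʳ-< new (s≤s (s≤s (s≤s z≤n))) ⟩
    new ℕ.+ 2 ℕ.* 2    ≤⟨ ℕP.+-monoʳ-≤ new (ℕP.*-monoʳ-≤ 2 2≤d) ⟩
    new ℕ.+ 2 ℕ.* d    ≡⟨ unit-move-balance a b a-b≢0 ⟩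
    sq a ℕ.+ sq b ℕ.+ 2 ∎)
  where
  open ℕP.≤-Reasoning
  d = ∣ a - b ∣
  new = sq (a - sgn (a - b)) ℕ.+ sq (b + sgn (a - b))
  a-b≢0 : a - b ≢ + 0
  a-b≢0 eq with subst (λ z → 2 ≤ ∣ z ∣) eq 2≤d
  ... | ()

-- Faces are named by their south-west corner: (a , b) is [a,a+1]×[b,b+1].
Face : Set
Face = ℤ × ℤ

-- The two faces containing an edge: the coboundary of a height function h is
-- δ h e = h (plus e) - h (minus e); plus e lies to the left of e, minus e to its right.
plus minus : Edge → Face
plus  (horiz x y) = (x , y)
plus  (vert x y)  = (x - + 1 , y)
minus (horiz x y) = (x , y - + 1)
minus (vert x y)  = (x , y)

δ : (Face → ℤ) → Config
δ h e = h (plus e) - h (minus e)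

HeightFunction : Config → (Face → ℤ) → Set
HeightFunction f h = ∀ e → f e ≡ δ h e

_≟F_ : (σ τ : Face) → Dec (σ ≡ τ)
_≟F_ = ≡-dec _≟_ _≟_

open import Data.List.Membership.DecPropositional _≟F_ using (_∈?_)
open import Data.List.Relation.Unary.Unique.DecPropositional.Properties _≟F_ using (deduplicate-!)

indicator : Bool → ℤ
indicator true  = + 1
indicator false = + 0

point : Face → Face → ℤ
point (a , b) (x , y) = indicator (⌊ x ≟ a ⌋ ∧ ⌊ y ≟ b ⌋)

point-self : ∀ σ → point σ σ ≡ + 1
point-self (a , b) with a ≟ a | b ≟ b
... | yes _ | yes _  = refl
... | no a≢a | _     = ⊥-elim (a≢a refl)
... | yes _ | no b≢b = ⊥-elim (b≢b refl)

point-other : ∀ {σ τ} → τ ≢ σ → point σ τ ≡ + 0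
point-other {a , b} {x , y} τ≢σ with x ≟ a | y ≟ b
... | yes refl | yes refl = ⊥-elim (τ≢σ refl)
... | yes _    | no _     = refl
... | no _     | _        = refl

pred≢ : ∀ y → y - + 1 ≢ y
pred≢ y eq = -1≢0 (begin
    - + 1        ≡⟨ sym (shift y) ⟩
    y - + 1 - y  ≡⟨ cong (_- y) eq ⟩
    y - y        ≡⟨ ℤP.+-inverseʳ y ⟩
    + 0          ∎)
  where
  open ≡-Reasoning
  shift : ∀ y → y - + 1 - y ≡ - + 1
  shift = ℤ-Ring.solve-∀
  -1≢0 : - + 1 ≢ + 0
  -1≢0 ()

plus≢minus : ∀ e → plus e ≢ minus e
plus≢minus (horiz x y) eq = pred≢ y (sym (cong proj₂ eq))
plus≢minus (vert x y)  eq = pred≢ x (cong proj₁ eq)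

cycle : Face → Config
cycle (a , b) = cyc a b

pred-test : ∀ y b → ⌊ y - + 1 ≟ b ⌋ ≡ ⌊ y ≟ b + + 1 ⌋
pred-test y b with y - + 1 ≟ b | y ≟ b + + 1
... | yes _ | yes _ = refl
... | no _  | no _  = refl
... | yes p | no q  = ⊥-elim (q (trans (sym (pred+1 y)) (cong (_+ + 1) p)))
  where pred+1 : ∀ y → y - + 1 + + 1 ≡ y
        pred+1 = ℤ-Ring.solve-∀
... | no p  | yes q = ⊥-elim (p (trans (cong (_- + 1) q) (succ-1 b)))
  where succ-1 : ∀ b → b + + 1 - + 1 ≡ b
        succ-1 = ℤ-Ring.solve-∀

δ-point : ∀ σ e → δ (point σ) e ≡ cycle σ e
δ-point (a , b) (horiz x y) rewrite pred-test y b
  with ⌊ x ≟ a ⌋ ∧ ⌊ y ≟ b ⌋ | ⌊ x ≟ a ⌋ ∧ ⌊ y ≟ b + + 1 ⌋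
... | true  | true  = refl
... | true  | false = refl
... | false | true  = refl
... | false | false = refl
δ-point (a , b) (vert x y) rewrite pred-test x a
  with ⌊ x ≟ a + + 1 ⌋ ∧ ⌊ y ≟ b ⌋ | ⌊ x ≟ a ⌋ ∧ ⌊ y ≟ b ⌋
... | true  | true  = refl
... | true  | false = refl
... | false | true  = refl
... | false | false = refl

cycle-plus : ∀ e → cycle (plus e) e ≡ + 1
cycle-plus e = begin
  cycle (plus e) e                               ≡⟨ sym (δ-point (plus e) e) ⟩
  point (plus e) (plus e) - point (plus e) (minus e)
    ≡⟨ cong₂ _-_ (point-self (plus e)) (point-other (plus≢minus e ∘ sym)) ⟩
  + 1                                            ∎
  where open ≡-Reasoning

cycle-minus : ∀ e → cycle (minus e) e ≡ - + 1
cycle-minus e = begin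
  cycle (minus e) e                               ≡⟨ sym (δ-point (minus e) e) ⟩
  point (minus e) (plus e) - point (minus e) (minus e)
    ≡⟨ cong₂ _-_ (point-other (plus≢minus e)) (point-self (minus e)) ⟩
  - + 1                                           ∎
  where open ≡-Reasoning

bump : (Face → ℤ) → Face → ℤ → Face → ℤ
bump h σ c τ = h τ + c * point σ τ

bump-self : ∀ h σ c → bump h σ c σ ≡ h σ + c
bump-self h σ c = cong (λ v → h σ + v) (trans (cong (c *_) (point-self σ)) (ℤP.*-identityʳ c))

bump-other : ∀ h {σ} c {τ} → τ ≢ σ → bump h σ c τ ≡ h τ
bump-other h c {τ} τ≢σ = trans (cong (λ v → h τ + c * v) (point-other τ≢σ))
                               (trans (cong (λ v → h τ + v) (ℤP.*-zeroʳ c)) (ℤP.+-identityʳ (h τ)))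

δ-bump : ∀ h σ c e → δ (bump h σ c) e ≡ δ h e + c * cycle σ e
δ-bump h σ c e = begin
    (h (plus e) + c * point σ (plus e)) - (h (minus e) + c * point σ (minus e))
  ≡⟨ regroup (h (plus e)) (h (minus e)) c (point σ (plus e)) (point σ (minus e)) ⟩
    δ h e + c * δ (point σ) e
  ≡⟨ cong (λ v → δ h e + c * v) (δ-point σ e) ⟩
    δ h e + c * cycle σ e
  ∎
  where
  open ≡-Reasoning
  regroup : ∀ p q c u v → (p + c * u) - (q + c * v) ≡ (p - q) + c * (u - v)
  regroup = ℤ-Ring.solve-∀

-- Firing e (with |f e| ≥ 2) subtracts s times the cycle of plus e and adds s times
-- the cycle of minus e, for s the sign of f e; the order of the two reroutes differs
-- between horizontal and vertical edges but both use the sign s.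
fire-formula : ∀ f e → 2 ≤ ∣ f e ∣ → ∀ e' →
  fire f e e' ≡ f e' - sgn (f e) * cycle (plus e) e' + sgn (f e) * cycle (minus e) e'
fire-formula f e@(horiz x y) big e'
  rewrite cycle-plus e | cycle-minus e | sgn-after-unit (f e) big =
    reorder (f e') (sgn (f e)) (cyc x y e') (cyc x (y - + 1) e')
  where
  reorder : ∀ g s p m → g - s * (+ 1 * p) - s * (- + 1 * m) ≡ g - s * p + s * m
  reorder = ℤ-Ring.solve-∀
fire-formula f e@(vert x y) big e'
  rewrite cycle-plus e | cycle-minus e | sgn-after-unit (f e) big =
    reorder (f e') (sgn (f e)) (cyc (x - + 1) y e') (cyc x y e')
  where
  reorder : ∀ g s p m → g - s * (- + 1 * m) - s * (+ 1 * p) ≡ g - s * p + s * m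
  reorder = ℤ-Ring.solve-∀

fired : (Face → ℤ) → Edge → ℤ → Face → ℤ
fired h e s = bump (bump h (plus e) (- s)) (minus e) s

fire-height : ∀ {f} h e → 2 ≤ ∣ f e ∣ → HeightFunction f h →
  HeightFunction (fire f e) (fired h e (sgn (f e)))
fire-height {f} h e big is-height e' = begin
    fire f e e'
  ≡⟨ fire-formula f e big e' ⟩
    f e' - s * cycle (plus e) e' + s * cycle (minus e) e'
  ≡⟨ cong₂ (λ u v → u + v + s * cycle (minus e) e') (is-height e') (ℤP.neg-distribˡ-* s _) ⟩
    δ h e' + - s * cycle (plus e) e' + s * cycle (minus e) e'
  ≡⟨ cong (_+ s * cycle (minus e) e') (sym (δ-bump h (plus e) (- s) e')) ⟩
    δ (bump h (plus e) (- s)) e' + s * cycle (minus e) e'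
  ≡⟨ sym (δ-bump (bump h (plus e) (- s)) (minus e) s e') ⟩
    δ (fired h e s) e'
  ∎
  where
  open ≡-Reasoning
  s = sgn (f e)

energy : List Face → (Face → ℤ) → ℕ
energy L h = sum (map (λ σ → sq (h σ)) L)

energy-cong : ∀ L {h h'} → (∀ {τ} → τ ∈ L → h' τ ≡ h τ) → energy L h' ≡ energy L h
energy-cong []      _    = refl
energy-cong (σ ∷ L) h'≗h = cong₂ (λ u v → sq u ℕ.+ v) (h'≗h (here refl)) (energy-cong L (h'≗h ∘ there))

energy-bump : ∀ {L} h {σ} c → Unique L → σ ∈ L →
  energy L (bump h σ c) ℕ.+ sq (h σ) ≡ energy L h ℕ.+ sq (h σ + c)
energy-bump {σ ∷ L} h c (σ-distinct ∷ _) (here refl) = begin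
    sq (bump h σ c σ) ℕ.+ energy L (bump h σ c) ℕ.+ sq (h σ)
  ≡⟨ cong₂ (λ u v → sq u ℕ.+ v ℕ.+ sq (h σ)) (bump-self h σ c)
           (energy-cong L (λ τ∈L → bump-other h c (All.lookup σ-distinct τ∈L ∘ sym))) ⟩
    sq (h σ + c) ℕ.+ energy L h ℕ.+ sq (h σ)
  ≡⟨ swap (sq (h σ + c)) (energy L h) (sq (h σ)) ⟩
    sq (h σ) ℕ.+ energy L h ℕ.+ sq (h σ + c)
  ∎
  where
  open ≡-Reasoning
  swap : ∀ p q r → p ℕ.+ q ℕ.+ r ≡ r ℕ.+ q ℕ.+ p
  swap = ℕ-Ring.solve-∀
energy-bump {ρ ∷ L} h {σ} c (ρ-distinct ∷ unique) (there σ∈L) = begin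
    sq (bump h σ c ρ) ℕ.+ energy L (bump h σ c) ℕ.+ sq (h σ)
  ≡⟨ cong (λ u → sq u ℕ.+ energy L (bump h σ c) ℕ.+ sq (h σ)) (bump-other h c (All.lookup ρ-distinct σ∈L)) ⟩
    sq (h ρ) ℕ.+ energy L (bump h σ c) ℕ.+ sq (h σ)
  ≡⟨ ℕP.+-assoc (sq (h ρ)) _ _ ⟩
    sq (h ρ) ℕ.+ (energy L (bump h σ c) ℕ.+ sq (h σ))
  ≡⟨ cong (sq (h ρ) ℕ.+_) (energy-bump h c unique σ∈L) ⟩
    sq (h ρ) ℕ.+ (energy L h ℕ.+ sq (h σ + c))
  ≡⟨ ℕP.+-assoc (sq (h ρ)) _ _ ⟨
    sq (h ρ) ℕ.+ energy L h ℕ.+ sq (h σ + c)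
  ∎
  where open ≡-Reasoning

record Cover (h : Face → ℤ) (L : List Face) : Set where
  field
    unique : Unique L
    covers : ∀ {τ} → h τ ≢ + 0 → τ ∈ L
open Cover

outside-zero : ∀ {h L τ} → Cover h L → τ ∉ L → h τ ≡ + 0
outside-zero {h} {τ = τ} C τ∉L with h τ ≟ + 0
... | yes hτ≡0 = hτ≡0
... | no  hτ≢0 = ⊥-elim (τ∉L (covers C hτ≢0))

bump-cover : ∀ {h L σ} c → Cover h L → σ ∈ L → Cover (bump h σ c) L
bump-cover {h} {L} {σ} c C σ∈L = record { unique = unique C ; covers = bumped-covers }
  where
  bumped-covers : ∀ {τ} → bump h σ c τ ≢ + 0 → τ ∈ L
  bumped-covers {τ} nonzero with τ ≟F σ
  ... | yes refl = σ∈L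
  ... | no τ≢σ   = covers C (nonzero ∘ trans (bump-other h c τ≢σ))

-- Any face can be added to a cover without changing the energy: if it is new,
-- its height is 0.
record Extension (h : Face → ℤ) (L : List Face) (σ : Face) : Set where
  field
    list        : List Face
    cover       : Cover h list
    has         : σ ∈ list
    keeps       : L ⊆ list
    same-energy : energy list h ≡ energy L h
open Extension

cover-extend : ∀ {h L} → Cover h L → ∀ σ → Extension h L σ
cover-extend {h} {L} C σ with σ ∈? L
... | yes σ∈L = record { list = L ; cover = C ; has = σ∈L ; keeps = id ; same-energy = refl }
... | no  σ∉L = record
  { list        = σ ∷ L
  ; cover       = record { unique = ¬Any⇒All¬ L σ∉L ∷ unique C ; covers = there ∘ covers C }
  ; has         = here refl
  ; keeps       = there
  ; same-energy = cong (λ v → sq v ℕ.+ energy L h) (outside-zero C σ∉L)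
  }

two-exchanges : ∀ E E₁ E₂ a b a' b' → E₁ ℕ.+ a ≡ E ℕ.+ a' → E₂ ℕ.+ b ≡ E₁ ℕ.+ b' →
  a' ℕ.+ b' < a ℕ.+ b → E₂ < E
two-exchanges E E₁ E₂ a b a' b' first second smaller = ℕP.+-cancelʳ-< (a ℕ.+ b) E₂ E (begin-strict
    E₂ ℕ.+ (a ℕ.+ b)     ≡⟨ rearrange E₂ b a ⟩
    E₂ ℕ.+ b ℕ.+ a       ≡⟨ cong (ℕ._+ a) second ⟩
    E₁ ℕ.+ b' ℕ.+ a      ≡⟨ swap-last E₁ b' a ⟩
    E₁ ℕ.+ a ℕ.+ b'      ≡⟨ cong (ℕ._+ b') first ⟩
    E ℕ.+ a' ℕ.+ b'      ≡⟨ ℕP.+-assoc E a' b' ⟩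
    E ℕ.+ (a' ℕ.+ b')    <⟨ ℕP.+-monoʳ-< E smaller ⟩
    E ℕ.+ (a ℕ.+ b)      ∎)
  where
  open ℕP.≤-Reasoning
  rearrange : ∀ p q r → p ℕ.+ (r ℕ.+ q) ≡ p ℕ.+ q ℕ.+ r
  rearrange = ℕ-Ring.solve-∀
  swap-last : ∀ p q r → p ℕ.+ q ℕ.+ r ≡ p ℕ.+ r ℕ.+ q
  swap-last = ℕ-Ring.solve-∀

record Certificate (f : Config) : Set where
  field
    height    : Face → ℤ
    faces     : List Face
    is-height : HeightFunction f height
    covering  : Cover height faces

certificate-energy : ∀ {f} → Certificate f → ℕ
certificate-energy C = energy (Certificate.faces C) (Certificate.height C)

-- Firing an edge with |f e| ≥ 2 yields a certificate of strictly smaller energy: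
-- the heights a, b of plus e, minus e become a - s, b + s with s = sgn (a - b).
fire-certificate : ∀ {f} e → 2 ≤ ∣ f e ∣ → (C : Certificate f) →
  Σ (Certificate (fire f e)) λ C' → certificate-energy C' < certificate-energy C
fire-certificate {f} e big C = C' , decrease
  where
  open Certificate C using (faces; is-height; covering) renaming (height to h)
  s = sgn (f e)
  a = h (plus e)
  b = h (minus e)
  -- Enlarge the cover so that it contains both faces of e.
  X₁ = cover-extend covering (plus e)
  X₂ = cover-extend (cover X₁) (minus e)
  L  = list X₂
  plus∈L : plus e ∈ L
  plus∈L = keeps X₂ (has X₁)
  h₁ = bump h (plus e) (- s)
  C' : Certificate (fire f e)
  C' = record
    { height    = fired h e s
    ; faces     = L
    ; is-height = fire-height h e big is-height
    ; covering  = bump-cover s (bump-cover (- s) (cover X₂) plus∈L) (has X₂)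
    }
  h₁-minus : h₁ (minus e) ≡ b
  h₁-minus = bump-other h (- s) (plus≢minus e ∘ sym)
  first : energy L h₁ ℕ.+ sq a ≡ energy faces h ℕ.+ sq (a - s)
  first = trans (energy-bump h (- s) (unique (cover X₂)) plus∈L)
                (cong (ℕ._+ sq (a - s)) (trans (same-energy X₂) (same-energy X₁)))
  second : energy L (fired h e s) ℕ.+ sq b ≡ energy L h₁ ℕ.+ sq (b + s)
  second = subst (λ v → energy L (fired h e s) ℕ.+ sq v ≡ energy L h₁ ℕ.+ sq (v + s)) h₁-minus
                 (energy-bump h₁ s (unique (cover X₂)) (has X₂))
  s≡ : s ≡ sgn (a - b)
  s≡ = cong sgn (is-height e)
  smaller : sq (a - s) ℕ.+ sq (b + s) < sq a ℕ.+ sq b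
  smaller = subst (λ t → sq (a - t) ℕ.+ sq (b + t) < sq a ℕ.+ sq b) (sym s≡)
                  (unit-move-decreases a b (subst (λ z → 2 ≤ ∣ z ∣) (is-height e) big))
  decrease : certificate-energy C' < certificate-energy C
  decrease = two-exchanges (energy faces h) (energy L h₁) (energy L (fired h e s))
               (sq a) (sq b) (sq (a - s)) (sq (b + s)) first second smaller

xc yc : Edge → ℤ
xc (horiz x _) = x
xc (vert x _)  = x
yc (horiz _ y) = y
yc (vert _ y)  = y

Inside : ℕ → ℤ → Set
Inside B z = - + B ℤ.< z × z ℤ.< + B

inside? : ∀ B z → Dec (Inside B z)
inside? B z = (- + B ℤP.<? z) ×-dec (z ℤP.<? + B)

abs<⇒inside : ∀ {B z} → ∣ z ∣ < B → Inside B z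
abs<⇒inside {suc b} {+ n}      n<B       = ℤ.-<+ , ℤ.+<+ n<B
abs<⇒inside {suc b} { -[1+ n ]} (s≤s n<b) = ℤ.-<- n<b , ℤ.-<+

inside⇒abs< : ∀ {B z} → Inside B z → ∣ z ∣ < B
inside⇒abs< {B}     {+ n}      (_ , n<B)       = ℤP.drop‿+<+ n<B
inside⇒abs< {suc b} { -[1+ n ]} (-[1+b]<z , _) = s≤s (ℤP.drop‿-<- -[1+b]<z)
inside⇒abs< {zero}  { -[1+ n ]} (() , _)

radius : List Edge → ℕ
radius []      = 0
radius (e ∷ L) = suc (∣ xc e ∣ ℕ.+ ∣ yc e ∣) ℕ.+ radius L

radius-bound : ∀ {e L} → e ∈ L → Inside (radius L) (xc e) × Inside (radius L) (yc e)
radius-bound {e} {L} e∈L = abs<⇒inside (bound e∈L (ℕP.m≤m+n _ _)) , abs<⇒inside (bound e∈L (ℕP.m≤n+m _ _))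
  where
  bound : ∀ {e L c} → e ∈ L → c ≤ ∣ xc e ∣ ℕ.+ ∣ yc e ∣ → c < radius L
  bound {L = e ∷ L} (here refl) c≤ = ℕP.≤-trans (s≤s c≤) (ℕP.m≤m+n _ (radius L))
  bound {L = e ∷ L} (there e∈L) c≤ = ℕP.≤-trans (bound e∈L c≤) (ℕP.m≤n+m _ _)

ball : ℕ → List ℤ
ball zero    = []
ball (suc n) = + n ∷ - + n ∷ ball n

∈-ball : ∀ {z n} → ∣ z ∣ < n → z ∈ ball n
∈-ball {z} {suc n} (s≤s ∣z∣≤n) with ℕP.m≤n⇒m<n∨m≡n ∣z∣≤n
... | inj₁ ∣z∣<n = there (there (∈-ball ∣z∣<n))
∈-ball {+ n}      {suc n} _ | inj₂ refl = here refl
∈-ball { -[1+ k ]} {suc _} _ | inj₂ refl = there (here refl)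

-- Heights of a conservative flow supported inside the square (-B, B)²: the height of
-- face (x, y) is the total flow through the horizontal edges horiz x y' with
-- -B < y' ≤ y, i.e. those of its column from the base line up to its bottom edge.
module Heights (f : Config) (conservative : Conservative f) (B : ℕ)
               (bounded : ∀ e → f e ≢ + 0 → Inside B (xc e) × Inside B (yc e)) where

  base : ℤ
  base = - + B

  quiet : ∀ e → ¬ (Inside B (xc e) × Inside B (yc e)) → f e ≡ + 0
  quiet e outside with f e ≟ + 0
  ... | yes fe≡0 = fe≡0
  ... | no  fe≢0 = ⊥-elim (outside (bounded e fe≢0))

  quiet-x : ∀ e → ¬ Inside B (xc e) → f e ≡ + 0
  quiet-x e outside = quiet e (outside ∘ proj₁)

  quiet-y : ∀ e → ¬ Inside B (yc e) → f e ≡ + 0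
  quiet-y e outside = quiet e (outside ∘ proj₂)

  below-base : ∀ {d} → d ℤ.≤ + 0 → ¬ Inside B (base + d)
  below-base {d} d≤0 (base<base+d , _) =
    ℤP.<⇒≱ base<base+d (subst (base + d ℤ.≤_) (ℤP.+-identityʳ base) (ℤP.+-monoʳ-≤ base d≤0))

  colSum : ℤ → ℕ → ℤ
  colSum x zero    = + 0
  colSum x (suc k) = colSum x k + f (horiz x (base + + suc k))

  column : ℤ → ℤ → ℤ
  column x (+ k)      = colSum x k
  column x -[1+ _ ]   = + 0

  height : Face → ℤ
  height (x , y) = column x (y - base)

  rebase : ∀ y → base + (y - base) ≡ y
  rebase y = shift base y
    where shift : ∀ m y → m + (y - m) ≡ y
          shift = ℤ-Ring.solve-∀

  step-down : ∀ k → base + +[1+ k ] - + 1 ≡ base + + k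
  step-down k = lower base (+ k)
    where lower : ∀ m k → m + (+ 1 + k) - + 1 ≡ m + k
          lower = ℤ-Ring.solve-∀

  column-horizontal : ∀ x d → f (horiz x (base + d)) ≡ column x d - column x (d - + 1)
  column-horizontal x (+ zero)  = quiet-y (horiz x (base + + 0)) (below-base (ℤ.+≤+ z≤n))
  column-horizontal x +[1+ k ]  = cancel (colSum x k) (f (horiz x (base + +[1+ k ])))
    where cancel : ∀ s g → g ≡ s + g - s
          cancel = ℤ-Ring.solve-∀
  column-horizontal x -[1+ n ]  = quiet-y (horiz x (base + -[1+ n ])) (below-base ℤ.-≤+)

  -- Vertical flows are differences of column sums of adjacent columns.  Induction
  -- up the column: conservation at (x, y) gives north = south + west - east.
  colSum-vertical : ∀ x k → f (vert x (base + + k)) ≡ colSum (x - + 1) k - colSum x k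
  colSum-vertical x zero    = quiet-y (vert x (base + + 0)) (below-base (ℤ.+≤+ z≤n))
  colSum-vertical x (suc k) = begin
      north
    ≡⟨ isolate-north west east north south P Q ⟩
      (P + west) - (Q + east) + (south - (P - Q)) - ((west + south) - (east + north))
    ≡⟨ cong₂ (λ u w → (P + west) - (Q + east) + u - w)
             (trans (cong (_- (P - Q)) (colSum-vertical x k)) (ℤP.+-inverseʳ (P - Q)))
             (subst (λ w → (west + f (vert x w)) - (east + north) ≡ + 0) (step-down k)
                    (conservative x y)) ⟩
      (P + west) - (Q + east) + + 0 - + 0
    ≡⟨ drop-zeros (P + west) (Q + east) ⟩
      (P + west) - (Q + east)
    ∎
    where
    open ≡-Reasoning
    y     = base + +[1+ k ]
    west  = f (horiz (x - + 1) y)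
    east  = f (horiz x y)
    north = f (vert x y)
    south = f (vert x (base + + k))
    P     = colSum (x - + 1) k
    Q     = colSum x k
    isolate-north : ∀ w e n s P Q →
      n ≡ (P + w) - (Q + e) + (s - (P - Q)) - ((w + s) - (e + n))
    isolate-north = ℤ-Ring.solve-∀
    drop-zeros : ∀ u v → u - v + + 0 - + 0 ≡ u - v
    drop-zeros = ℤ-Ring.solve-∀

  column-vertical : ∀ x d → f (vert x (base + d)) ≡ column (x - + 1) d - column x d
  column-vertical x (+ k)     = colSum-vertical x k
  column-vertical x -[1+ n ]  = quiet-y (vert x (base + -[1+ n ])) (below-base ℤ.-≤+)

  is-height : HeightFunction f height
  is-height (horiz x y) = begin
      f (horiz x y)
    ≡⟨ cong (f ∘ horiz x) (sym (rebase y)) ⟩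
      f (horiz x (base + (y - base)))
    ≡⟨ column-horizontal x (y - base) ⟩
      column x (y - base) - column x (y - base - + 1)
    ≡⟨ cong (λ v → column x (y - base) - column x v) (swap y base) ⟩
      height (x , y) - height (x , y - + 1)
    ∎
    where
    open ≡-Reasoning
    swap : ∀ y m → y - m - + 1 ≡ y - + 1 - m
    swap = ℤ-Ring.solve-∀
  is-height (vert x y) = subst (λ v → f (vert x v) ≡ height (x - + 1 , y) - height (x , y))
                               (rebase y) (column-vertical x (y - base))

  height-outside-x : ∀ {x} y → ¬ Inside B x → height (x , y) ≡ + 0
  height-outside-x {x} y outside = column-zero (y - base)
    where
    colSum-zero : ∀ k → colSum x k ≡ + 0
    colSum-zero zero    = refl
    colSum-zero (suc k) = cong₂ _+_ (colSum-zero k) (quiet-x (horiz x (base + + suc k)) outside)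
    column-zero : ∀ d → column x d ≡ + 0
    column-zero (+ k)     = colSum-zero k
    column-zero -[1+ _ ]  = refl

  height-below : ∀ x {y} → y ℤ.≤ base → height (x , y) ≡ + 0
  height-below x {y} y≤base with y - base in eq
  ... | + zero   = refl
  ... | -[1+ _ ] = refl
  ... | +[1+ k ] with () ← ℤP.<⇒≱ (ℤ.+<+ (s≤s z≤n)) (subst (ℤ._≤ + 0) eq (ℤP.i≤j⇒i-j≤0 y≤base))

  -- Above the square the heights of adjacent columns agree (the vertical flow
  -- between them vanishes), and they vanish at the left.
  height-above : ∀ x {y} → + B ℤ.≤ y → height (x , y) ≡ + 0
  height-above x {y} B≤y = subst (λ v → height (v , y) ≡ + 0) (rebase x) (from-left (x - base))
    where
    outside : ¬ Inside B y
    outside (_ , y<B) = ℤP.<⇒≱ y<B B≤y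
    from-left : ∀ d → height (base + d , y) ≡ + 0
    from-left (+ zero)  = height-outside-x y (below-base (ℤ.+≤+ z≤n))
    from-left -[1+ n ]  = height-outside-x y (below-base ℤ.-≤+)
    from-left +[1+ k ]  = begin
        height (base + +[1+ k ] , y)
      ≡⟨ ℤP.i-j≡0⇒i≡j _ _ (trans (sym (is-height (vert (base + +[1+ k ]) y))) (quiet-y _ outside)) ⟨
        height (base + +[1+ k ] - + 1 , y)
      ≡⟨ cong (λ v → height (v , y)) (step-down k) ⟩
        height (base + + k , y)
      ≡⟨ from-left (+ k) ⟩
        + 0
      ∎
      where open ≡-Reasoning

  height-outside-y : ∀ x {y} → ¬ Inside B y → height (x , y) ≡ + 0
  height-outside-y x {y} outside with base ℤP.<? y | y ℤP.<? + B
  ... | yes base<y | yes y<B = ⊥-elim (outside (base<y , y<B))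
  ... | no  base≮y | _       = height-below x (ℤP.≮⇒≥ base≮y)
  ... | yes _      | no  y≮B = height-above x (ℤP.≮⇒≥ y≮B)

  box : List Face
  box = deduplicate _≟F_ (cartesianProduct (ball B) (ball B))

  box-cover : Cover height box
  box-cover = record { unique = deduplicate-! _ ; covers = in-box }
    where
    forced : ∀ {P : Set} {z} → Dec P → (¬ P → z ≡ + 0) → z ≢ + 0 → P
    forced (yes p) _        _       = p
    forced (no ¬p) vanishes nonzero = ⊥-elim (nonzero (vanishes ¬p))
    in-box : ∀ {σ} → height σ ≢ + 0 → σ ∈ box
    in-box {x , y} nonzero = ∈-deduplicate⁺ _≟F_ (∈-cartesianProduct⁺
      (∈-ball (inside⇒abs< (forced (inside? B x) (height-outside-x y) nonzero)))
      (∈-ball (inside⇒abs< (forced (inside? B y) (height-outside-y x) nonzero))))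

  certificate : Certificate f
  certificate = record { height = height ; faces = box ; is-height = is-height ; covering = box-cover }

initial-certificate : ∀ f → Conservative f → FiniteSupport f → Certificate f
initial-certificate f conservative (L , support) =
  Heights.certificate f conservative (radius L) (λ e fe≢0 → radius-bound (support e fe≢0))

no-infinite-descent : (g : ℕ → ℕ) → (∀ n → g (suc n) < g n) → ⊥
no-infinite-descent g down = descend 0 (<-wellFounded (g 0))
  where
  descend : ∀ n → Acc _<_ (g n) → ⊥
  descend n (acc smaller) = descend (suc n) (smaller (down n))

-- Along a run that fires forever, certificates carried
-- from one configuration to the next have strictly decreasing energies.
theorem5p2 : (f : Config) → Conservative f → FiniteSupport f →
    (es : ℕ → Edge) → ¬ (∀ (n : ℕ) → 2 ≤ ∣ run f es n (es n) ∣)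
theorem5p2 f conservative finite es firable =
  no-infinite-descent (certificate-energy ∘ certificate) decreasing
  where
  step : ∀ n (C : Certificate (run f es n)) →
    Σ (Certificate (run f es (suc n))) λ C' → certificate-energy C' < certificate-energy C
  step n = fire-certificate (es n) (firable n)
  certificate : (n : ℕ) → Certificate (run f es n)
  certificate zero    = initial-certificate f conservative finite
  certificate (suc n) = proj₁ (step n (certificate n))
  decreasing : ∀ n → certificate-energy (certificate (suc n)) < certificate-energy (certificate n)
  decreasing n = proj₂ (step n (certificate n))
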